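{- The category whose objects are the posets $\langle L\otimes U,\leq_p\rangle$ for approximation tuples $(L,U,\leq)$ and whose morphisms are the monotone functions between them is a Cartesian closed full subcategory of the category of chain-complete posets with monotone functions.
   Context: An approximation tuple is a tuple $(L,U,\leq)$ where $L,U$ are sets and $\leq$ is a partial order on $L\cup U$ such that: $\langle L\cup U,\leq\rangle$ has a top element $\top$ and bottom element $\bot$; $\top,\bot\in L\cap U$; $\langle L,\leq\rangle$ and $\langle U,\leq\rangle$ are complete lattices; (ILP) for all $b\in U$ and all $S\subseteq L$ with $x\leq b$ for every $x\in S$, the least upper bound of $S$ in $L$ is $\leq b$; (IGP) for all $a\in L$ and all $S\subseteq U$ with $a\leq x$ for every $x\in S$, $a$ is $\leq$ the greatest lower bound of $S$ in $U$. The associated approximation space is $L\otimes U=\{(x,y)\mid x\in L, y\in U, x\leq y\}$ with the precision order $(x_1,y_1)\leq_p(x_2,y_2)$ iff $x_1\leq x_2$ and $y_2\leq y_1$. A category is Cartesian closed if it has a terminal object, binary products and exponentials. -}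

module Defs where

open import Level using (Level; 0ℓ; suc; _⊔_)
open import Data.Product using (Σ; Σ-syntax; _×_; _,_; proj₁; proj₂)
open import Data.Sum using (_⊎_; inj₁; inj₂)
open import Relation.Binary.Bundles using (Poset)
open import Relation.Binary.Structures using (IsEquivalence; IsPreorder; IsPartialOrder)

module _ (P : Poset 0ℓ 0ℓ 0ℓ) where
  open Poset P

  Subset : Set₁
  Subset = Carrier → Set

  _⊆_ : Subset → Subset → Set
  S ⊆ T = ∀ x → S x → T x

  IsUpperBound : Subset → Carrier → Set
  IsUpperBound S x = ∀ s → S s → s ≤ x

  IsLowerBound : Subset → Carrier → Set
  IsLowerBound S x = ∀ s → S s → x ≤ s

  IsLubIn : Subset → Subset → Carrier → Set
  IsLubIn Q S x = Q x × IsUpperBound S x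
                  × (∀ b → Q b → IsUpperBound S b → x ≤ b)

  IsGlbIn : Subset → Subset → Carrier → Set
  IsGlbIn Q S x = Q x × IsLowerBound S x
                  × (∀ b → Q b → IsLowerBound S b → b ≤ x)

  IsCompleteLatticeOn : Subset → Set₁
  IsCompleteLatticeOn Q =
    ∀ (S : Subset) → S ⊆ Q →
      (Σ[ x ∈ Carrier ] IsLubIn Q S x) × (Σ[ x ∈ Carrier ] IsGlbIn Q S x)

  IsLub : Subset → Carrier → Set
  IsLub S x = IsUpperBound S x × (∀ b → IsUpperBound S b → x ≤ b)

  IsChain : Subset → Set
  IsChain C = ∀ x y → C x → C y → (x ≤ y) ⊎ (y ≤ x)

  IsChainComplete : Set₁
  IsChainComplete = ∀ (C : Subset) → IsChain C → Σ[ x ∈ Carrier ] IsLub C x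

-- Approximation tuples.  The poset ⟨L ∪ U , ≤⟩ is 'base', and L, U are
-- predicates on its carrier covering it.

record ApproxTuple : Set₁ where
  field
    base : Poset 0ℓ 0ℓ 0ℓ
  open Poset base
  field
    L U   : Carrier → Set
    cover : ∀ a → L a ⊎ U a
    ⊤ ⊥   : Carrier
    ⊤-max : ∀ a → a ≤ ⊤
    ⊥-min : ∀ a → ⊥ ≤ a
    ⊤∈L : L ⊤
    ⊤∈U : U ⊤
    ⊥∈L : L ⊥
    ⊥∈U : U ⊥
    L-complete : IsCompleteLatticeOn base L
    U-complete : IsCompleteLatticeOn base U
    ILP : ∀ b → U b → ∀ (S : Subset base) → _⊆_ base S L →
            IsUpperBound base S b →
            ∀ x → IsLubIn base L S x → x ≤ b
    IGP : ∀ a → L a → ∀ (S : Subset base) → _⊆_ base S U →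
            IsLowerBound base S a →
            ∀ x → IsGlbIn base U S x → a ≤ x

module _ (T : ApproxTuple) where
  open ApproxTuple T
  open Poset base

  record ⊗Elem : Set where
    constructor ⟨_,_⟩[_,_,_]
    field
      lo hi : Carrier
      lo∈L : L lo
      hi∈U : U hi
      lo≤hi : lo ≤ hi

  open ⊗Elem

  _≈p_ : ⊗Elem → ⊗Elem → Set
  p ≈p q = (lo p ≈ lo q) × (hi p ≈ hi q)

  _≤p_ : ⊗Elem → ⊗Elem → Set
  p ≤p q = (lo p ≤ lo q) × (hi q ≤ hi p)

  ApproxSpace : Poset 0ℓ 0ℓ 0ℓ
  ApproxSpace = record
    { Carrier = ⊗Elem
    ; _≈_ = _≈p_
    ; _≤_ = _≤p_
    ; isPartialOrder = record
      { isPreorder = record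
        { isEquivalence = record
          { refl = Eq.refl , Eq.refl
          ; sym = λ (a , b) → Eq.sym a , Eq.sym b
          ; trans = λ (a , b) (c , d) → Eq.trans a c , Eq.trans b d
          }
        ; reflexive = λ (a , b) → reflexive a , reflexive (Eq.sym b)
        ; trans = λ (a , b) (c , d) → trans a c , trans d b
        }
      ; antisym = λ (a , b) (c , d) → antisym a c , antisym d b
      }
    }

record Category (o h e : Level) : Set (suc (o ⊔ h ⊔ e)) where
  infixr 9 _∘_
  infix 4 _≈_
  field
    Obj : Set o
    Hom : Obj → Obj → Set h
    _≈_ : ∀ {A B} → Hom A B → Hom A B → Set e
    ≈-equiv : ∀ {A B} → IsEquivalence (_≈_ {A} {B})
    id  : ∀ {A} → Hom A A
    _∘_ : ∀ {A B C} → Hom B C → Hom A B → Hom A C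
    identityˡ : ∀ {A B} {f : Hom A B} → id ∘ f ≈ f
    identityʳ : ∀ {A B} {f : Hom A B} → f ∘ id ≈ f
    assoc : ∀ {A B C D} {f : Hom A B} {g : Hom B C} {h : Hom C D} →
              (h ∘ g) ∘ f ≈ h ∘ (g ∘ f)
    ∘-resp-≈ : ∀ {A B C} {f f′ : Hom B C} {g g′ : Hom A B} →
                 f ≈ f′ → g ≈ g′ → f ∘ g ≈ f′ ∘ g′

FullSubcategory : ∀ {o h e i} (C : Category o h e) {I : Set i} →
                  (I → Category.Obj C) → Category i h e
FullSubcategory C {I} F = record
  { Obj = I
  ; Hom = λ A B → Hom (F A) (F B)
  ; _≈_ = _≈_
  ; ≈-equiv = ≈-equiv
  ; id = id
  ; _∘_ = _∘_
  ; identityˡ = identityˡ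
  ; identityʳ = identityʳ
  ; assoc = assoc
  ; ∘-resp-≈ = ∘-resp-≈
  }
  where open Category C

module _ {o h e} (C : Category o h e) where
  open Category C

  IsTerminal : Obj → Set (o ⊔ h ⊔ e)
  IsTerminal T = ∀ X → Σ[ ! ∈ Hom X T ] (∀ (g : Hom X T) → g ≈ !)

  IsProduct : (A B P : Obj) → Hom P A → Hom P B → Set (o ⊔ h ⊔ e)
  IsProduct A B P π₁ π₂ =
    ∀ X (f : Hom X A) (g : Hom X B) →
      Σ[ u ∈ Hom X P ] ((π₁ ∘ u ≈ f) × (π₂ ∘ u ≈ g)
        × (∀ (u′ : Hom X P) → π₁ ∘ u′ ≈ f → π₂ ∘ u′ ≈ g → u′ ≈ u))

  record Product (A B : Obj) : Set (o ⊔ h ⊔ e) where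
    field
      obj : Obj
      π₁ : Hom obj A
      π₂ : Hom obj B
      isProduct : IsProduct A B obj π₁ π₂

    ⟨_,_⟩ : ∀ {X} → Hom X A → Hom X B → Hom X obj
    ⟨ f , g ⟩ = proj₁ (isProduct _ f g)

  record Exponential (prod : ∀ A B → Product A B) (B C : Obj)
         : Set (o ⊔ h ⊔ e) where
    private
      module P A = Product (prod A B)
    field
      obj : Obj
      eval : Hom (P.obj obj) C
      isExponential :
        ∀ X (f : Hom (P.obj X) C) →
          Σ[ λf ∈ Hom X obj ]
            ((eval ∘ P.⟨_,_⟩ obj (λf ∘ P.π₁ X) (P.π₂ X) ≈ f)
            × (∀ (g : Hom X obj) →
                 eval ∘ P.⟨_,_⟩ obj (g ∘ P.π₁ X) (P.π₂ X) ≈ f → g ≈ λf))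

  record CartesianClosed : Set (o ⊔ h ⊔ e) where
    field
      terminal : Obj
      terminal-isTerminal : IsTerminal terminal
      product : ∀ A B → Product A B
      exponential : ∀ B C → Exponential product B C

record Monotone (P Q : Poset 0ℓ 0ℓ 0ℓ) : Set where
  constructor mono
  private
    module P = Poset P
    module Q = Poset Q
  field
    fun : P.Carrier → Q.Carrier
    monotone : ∀ {x y} → x P.≤ y → fun x Q.≤ fun y

open Monotone

record ChainCompletePoset : Set₁ where
  field
    poset : Poset 0ℓ 0ℓ 0ℓ
    chainComplete : IsChainComplete poset

open ChainCompletePoset

private
  fun-cong : ∀ {P Q} (f : Monotone P Q) {x y} →
             Poset._≈_ P x y → Poset._≈_ Q (fun f x) (fun f y)
  fun-cong {P} {Q} f x≈y =
    Poset.antisym Q (monotone f (Poset.reflexive P x≈y))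
                    (monotone f (Poset.reflexive P (Poset.Eq.sym P x≈y)))

ChainCompletePosets : Category (suc 0ℓ) 0ℓ 0ℓ
ChainCompletePosets = record
  { Obj = ChainCompletePoset
  ; Hom = λ A B → Monotone (poset A) (poset B)
  ; _≈_ = λ {A} {B} f g → ∀ x → Poset._≈_ (poset B) (fun f x) (fun g x)
  ; ≈-equiv = λ {A} {B} → record
    { refl = λ x → Poset.Eq.refl (poset B)
    ; sym = λ p x → Poset.Eq.sym (poset B) (p x)
    ; trans = λ p q x → Poset.Eq.trans (poset B) (p x) (q x)
    }
  ; id = mono (λ x → x) (λ p → p)
  ; _∘_ = λ f g → mono (λ x → fun f (fun g x)) (λ p → monotone f (monotone g p))
  ; identityˡ = λ {A} {B} x → Poset.Eq.refl (poset B)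
  ; identityʳ = λ {A} {B} x → Poset.Eq.refl (poset B)
  ; assoc = λ {A} {B} {C} {D} x → Poset.Eq.refl (poset D)
  ; ∘-resp-≈ = λ {A} {B} {C} {f} {f′} {g} {g′} p q x →
      Poset.Eq.trans (poset C) (fun-cong f (q x)) (p (fun g′ x))
  }

asCCPoset : (T : ApproxTuple) → IsChainComplete (ApproxSpace T) → ChainCompletePoset
asCCPoset T cc = record { poset = ApproxSpace T ; chainComplete = cc }

module Submission where

-- The lub of a chain in L ⊗ U is (⋁ lows in L, ⋀ highs in U): in a chain every low lies
-- below every high, so (IGP) puts each low below ⋀ highs and then (ILP) gives
-- ⋁ lows ≤ ⋀ highs.  The product of two tuples is (L₁ × L₂, U₁ × U₂) with the componentwise order;
-- the exponential B ⇒ C is (monotone maps L_B ⊗ U_B → L_C, antitone maps L_B ⊗ U_B → U_C)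
-- with the pointwise order, whose approximation space consists of the pairs f ≤ g, i.e.
-- of the monotone maps between the approximation spaces.  Completeness of L and U and
-- (ILP)/(IGP) are inherited componentwise resp. pointwise, since lubs of monotone and of
-- antitone families are computed pointwise.

open import Defs
open import Level using (0ℓ)
open import Data.Product using (Σ-syntax; _×_; _,_; proj₁; proj₂)
open import Data.Sum using (inj₁; inj₂)
open import Data.Unit using (tt) renaming (⊤ to Unit)
import Data.Unit.Properties as Unit
open import Function using (_∘_)
open import Data.Product.Relation.Binary.Pointwise.NonDependent using (×-poset)
open import Relation.Binary.Bundles using (Poset)
open import Relation.Binary.Core using (_Preserves_⟶_)
import Relation.Binary.Construct.On as On
import Relation.Binary.Properties.Poset as PosetProperties
open import Relation.Binary.PropositionalEquality using (_≡_; refl)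
open import Relation.Unary using (_∪_; _∩_; _⟨×⟩_)

Poset₀ : Set₁
Poset₀ = Poset 0ℓ 0ℓ 0ℓ

≥-poset : Poset₀ → Poset₀
≥-poset = PosetProperties.≥-poset


open ⊗Elem

module _ (P : Poset₀) where
  open Poset P

  Image : {A : Set} → (A → Carrier) → (A → Set) → Subset P
  Image f S x = Σ[ a ∈ _ ] S a × f a ≡ x

  image-⊆ : ∀ {A : Set} {f : A → Carrier} {S : A → Set} {Q : Subset P} →
            (∀ a → S a → Q (f a)) → _⊆_ P (Image f S) Q
  image-⊆ f∈Q _ (a , a∈S , refl) = f∈Q a a∈S

  HasLubsIn : Subset P → Set₁
  HasLubsIn Q = ∀ S → _⊆_ P S Q → Σ[ x ∈ Carrier ] IsLubIn P Q S x

  -- The paper's (ILP); (IGP) is this property of the dual order with L and U exchanged.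
  InterlatticeLubProperty : Subset P → Subset P → Set₁
  InterlatticeLubProperty L U =
    ∀ b → U b → ∀ (S : Subset P) → _⊆_ P S L → IsUpperBound P S b →
    ∀ x → IsLubIn P L S x → x ≤ b

  module _ {Q : Subset P} {S : Subset P} where

    lubIn-≤ : ∀ {x y} → IsLubIn P Q S x → IsLubIn P Q S y → x ≤ y
    lubIn-≤ (_ , _ , x-least) (y∈Q , y-ub , _) = x-least _ y∈Q y-ub

    lubIn-⊆ : ∀ {Q′ x} → _⊆_ P Q′ Q → Q′ x → IsLubIn P Q S x → IsLubIn P Q′ S x
    lubIn-⊆ Q′⊆Q x∈Q′ (_ , x-ub , x-least) =
      x∈Q′ , x-ub , λ b b∈Q′ → x-least b (Q′⊆Q b b∈Q′)

  interlatticeLub-viaLub :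
    ∀ {L U} →
    (∀ b → U b → ∀ S → _⊆_ P S L → IsUpperBound P S b →
       Σ[ y ∈ Carrier ] IsLubIn P L S y × y ≤ b) →
    InterlatticeLubProperty L U
  interlatticeLub-viaLub lub≤ b b∈U S S⊆L b-ub x x-lub =
    let (y , y-lub , y≤b) = lub≤ b b∈U S S⊆L b-ub in trans (lubIn-≤ x-lub y-lub) y≤b

module _ (P : Poset₀) {Q : Subset P} where

  lubs : IsCompleteLatticeOn P Q → HasLubsIn P Q
  lubs Q-complete S S⊆Q = proj₁ (Q-complete S S⊆Q)

  glbs : IsCompleteLatticeOn P Q → HasLubsIn (≥-poset P) Q
  glbs Q-complete S S⊆Q = proj₂ (Q-complete S S⊆Q)

  completeLattice : HasLubsIn P Q → HasLubsIn (≥-poset P) Q → IsCompleteLatticeOn P Q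
  completeLattice hasLubs hasGlbs S S⊆Q = hasLubs S S⊆Q , hasGlbs S S⊆Q

Restrict : (P : Poset₀) → Subset P → Poset₀
Restrict P R = On.poset P (proj₁ {B = R})

module _ (P : Poset₀) (R : Subset P) {Q : Subset P} (Q⊆R : _⊆_ P Q R) where

  restrict-hasLubs : HasLubsIn P Q → HasLubsIn (Restrict P R) (Q ∘ proj₁)
  restrict-hasLubs hasLubs S S⊆Q =
    let (x , x∈Q , x-ub , x-least) = hasLubs (Image P proj₁ S) (image-⊆ P S⊆Q)
    in (x , Q⊆R x x∈Q) , x∈Q , (λ a a∈S → x-ub (proj₁ a) (a , a∈S , refl))
                       , (λ b b∈Q b-ub → x-least (proj₁ b) b∈Q (image-⊆ P b-ub))

  restrict-projectLub : ∀ {S x} → IsLubIn (Restrict P R) (Q ∘ proj₁) S x →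
                        IsLubIn P Q (Image P proj₁ S) (proj₁ x)
  restrict-projectLub (x∈Q , x-ub , x-least) =
    x∈Q , image-⊆ P x-ub
    , λ b b∈Q b-ub → x-least (b , Q⊆R b b∈Q) b∈Q (λ a a∈S → b-ub (proj₁ a) (a , a∈S , refl))

module _ (P : Poset₀) (R : Subset P) where

  restrict-completeLattice : ∀ {Q} → _⊆_ P Q R → IsCompleteLatticeOn P Q →
                             IsCompleteLatticeOn (Restrict P R) (Q ∘ proj₁)
  restrict-completeLattice Q⊆R Q-complete =
    completeLattice (Restrict P R) (restrict-hasLubs P R Q⊆R (lubs P Q-complete))
                                   (restrict-hasLubs (≥-poset P) R Q⊆R (glbs P Q-complete))

  restrict-interlatticeLub : ∀ {L U} → _⊆_ P L R → InterlatticeLubProperty P L U →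
                             InterlatticeLubProperty (Restrict P R) (L ∘ proj₁) (U ∘ proj₁)
  restrict-interlatticeLub L⊆R ilp b b∈U S S⊆L b-ub x x-lub =
    ilp (proj₁ b) b∈U (Image P proj₁ S) (image-⊆ P S⊆L) (image-⊆ P b-ub)
        (proj₁ x) (restrict-projectLub P R L⊆R {S} {x} x-lub)

-- The axioms of an approximation tuple for L, U inside an ambient poset P whose order may
-- extend beyond L ∪ U; approxTupleOn cuts P down to L ∪ U.
module _ (P : Poset₀) where
  open Poset P

  record IsApproxTupleOn (L U : Subset P) : Set₁ where
    field
      ⊤ ⊥ : Carrier
      ⊤-max : ∀ a → a ≤ ⊤
      ⊥-min : ∀ a → ⊥ ≤ a
      ⊤∈L : L ⊤
      ⊤∈U : U ⊤
      ⊥∈L : L ⊥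
      ⊥∈U : U ⊥
      L-complete : IsCompleteLatticeOn P L
      U-complete : IsCompleteLatticeOn P U
      ILP : InterlatticeLubProperty P L U
      IGP : InterlatticeLubProperty (≥-poset P) U L

approxTupleOn : ∀ {P L U} → IsApproxTupleOn P L U → ApproxTuple
approxTupleOn {P} {L} {U} T = record
  { base = Restrict P (L ∪ U)
  ; L = L ∘ proj₁
  ; U = U ∘ proj₁
  ; cover = proj₂
  ; ⊤ = ⊤ , inj₁ ⊤∈L
  ; ⊥ = ⊥ , inj₁ ⊥∈L
  ; ⊤-max = ⊤-max ∘ proj₁
  ; ⊥-min = ⊥-min ∘ proj₁
  ; ⊤∈L = ⊤∈L
  ; ⊤∈U = ⊤∈U
  ; ⊥∈L = ⊥∈L
  ; ⊥∈U = ⊥∈U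
  ; L-complete = restrict-completeLattice P (L ∪ U) (λ _ → inj₁) L-complete
  ; U-complete = restrict-completeLattice P (L ∪ U) (λ _ → inj₂) U-complete
  ; ILP = restrict-interlatticeLub P (L ∪ U) (λ _ → inj₁) ILP
  ; IGP = restrict-interlatticeLub (≥-poset P) (L ∪ U) (λ _ → inj₂) IGP
  }
  where open IsApproxTupleOn T

module _ (T : ApproxTuple) where
  open ApproxTuple T
  open Poset base using (Carrier; _≤_; trans)

  IsConsistent : Subset (ApproxSpace T) → Set
  IsConsistent S = ∀ p q → S p → S q → lo p ≤ hi q

  chain-isConsistent : ∀ {C} → IsChain (ApproxSpace T) C → IsConsistent C
  chain-isConsistent chain p q p∈C q∈C with chain p q p∈C q∈C
  ... | inj₁ (lo-p≤lo-q , _) = trans lo-p≤lo-q (lo≤hi q)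
  ... | inj₂ (_ , hi-p≤hi-q) = trans (lo≤hi p) hi-p≤hi-q

  consistent-lub : ∀ {S} → IsConsistent S → Σ[ z ∈ ⊗Elem T ] IsLub (ApproxSpace T) S z
  consistent-lub {S} consistent =
    lub-from (lubs base L-complete Lows lows⊆L) (glbs base U-complete Highs highs⊆U)
    where
      Lows Highs : Subset base
      Lows = Image base lo S
      Highs = Image base hi S

      lows⊆L : _⊆_ base Lows L
      lows⊆L = image-⊆ base (λ p _ → lo∈L p)

      highs⊆U : _⊆_ base Highs U
      highs⊆U = image-⊆ base (λ p _ → hi∈U p)

      lub-from : Σ[ x ∈ Carrier ] IsLubIn base L Lows x → Σ[ y ∈ Carrier ] IsGlbIn base U Highs y →
                 Σ[ z ∈ ⊗Elem T ] IsLub (ApproxSpace T) S z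
      lub-from (x , x-lub@(x∈L , x-ub , x-least)) (y , y-glb@(y∈U , y-lb , y-greatest)) =
        ⟨ x , y ⟩[ x∈L , y∈U , x≤y ]
        , (λ p p∈S → x-ub (lo p) (p , p∈S , refl) , y-lb (hi p) (p , p∈S , refl))
        , (λ b b-ub → x-least (lo b) (lo∈L b) (image-⊆ base (λ p p∈S → proj₁ (b-ub p p∈S)))
                    , y-greatest (hi b) (hi∈U b) (image-⊆ base (λ p p∈S → proj₂ (b-ub p p∈S))))
        where
          lo≤y : ∀ p → S p → lo p ≤ y
          lo≤y p p∈S = IGP (lo p) (lo∈L p) Highs highs⊆U
                           (image-⊆ base (λ q q∈S → consistent p q p∈S q∈S)) y y-glb

          x≤y : x ≤ y
          x≤y = ILP y y∈U Lows lows⊆L (image-⊆ base lo≤y) x x-lub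

approxSpace-chainComplete : ∀ T → IsChainComplete (ApproxSpace T)
approxSpace-chainComplete T C chain = consistent-lub T (chain-isConsistent T chain)

module ComponentwiseLub (P₁ P₂ : Poset₀) {Q₁ : Subset P₁} {Q₂ : Subset P₂}
         (lubs₁ : HasLubsIn P₁ Q₁) (lubs₂ : HasLubsIn P₂ Q₂)
         (S : Subset (×-poset P₁ P₂)) (S⊆Q : _⊆_ (×-poset P₁ P₂) S (Q₁ ⟨×⟩ Q₂)) where

  components₁⊆Q : _⊆_ P₁ (Image P₁ proj₁ S) Q₁
  components₁⊆Q = image-⊆ P₁ (λ p p∈S → proj₁ (S⊆Q p p∈S))

  components₂⊆Q : _⊆_ P₂ (Image P₂ proj₂ S) Q₂
  components₂⊆Q = image-⊆ P₂ (λ p p∈S → proj₂ (S⊆Q p p∈S))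

  lub₁ : Σ[ x ∈ Poset.Carrier P₁ ] IsLubIn P₁ Q₁ (Image P₁ proj₁ S) x
  lub₁ = lubs₁ (Image P₁ proj₁ S) components₁⊆Q

  lub₂ : Σ[ x ∈ Poset.Carrier P₂ ] IsLubIn P₂ Q₂ (Image P₂ proj₂ S) x
  lub₂ = lubs₂ (Image P₂ proj₂ S) components₂⊆Q

  componentwiseLub : Poset.Carrier (×-poset P₁ P₂)
  componentwiseLub = proj₁ lub₁ , proj₁ lub₂

  componentwiseLub-isLub : IsLubIn (×-poset P₁ P₂) (Q₁ ⟨×⟩ Q₂) S componentwiseLub
  componentwiseLub-isLub =
    let (x₁∈Q , x₁-ub , x₁-least) = proj₂ lub₁
        (x₂∈Q , x₂-ub , x₂-least) = proj₂ lub₂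
    in (x₁∈Q , x₂∈Q)
     , (λ p p∈S → x₁-ub (proj₁ p) (p , p∈S , refl) , x₂-ub (proj₂ p) (p , p∈S , refl))
     , (λ b (b₁∈Q , b₂∈Q) b-ub →
          x₁-least (proj₁ b) b₁∈Q (image-⊆ P₁ (λ p p∈S → proj₁ (b-ub p p∈S)))
        , x₂-least (proj₂ b) b₂∈Q (image-⊆ P₂ (λ p p∈S → proj₂ (b-ub p p∈S))))

module _ (P₁ P₂ : Poset₀) where

  ×-hasLubs : ∀ {Q₁ Q₂} → HasLubsIn P₁ Q₁ → HasLubsIn P₂ Q₂ →
              HasLubsIn (×-poset P₁ P₂) (Q₁ ⟨×⟩ Q₂)
  ×-hasLubs lubs₁ lubs₂ S S⊆Q = componentwiseLub , componentwiseLub-isLub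
    where open ComponentwiseLub P₁ P₂ lubs₁ lubs₂ S S⊆Q

  ×-interlatticeLub : ∀ {L₁ U₁ L₂ U₂} → HasLubsIn P₁ L₁ → HasLubsIn P₂ L₂ →
                      InterlatticeLubProperty P₁ L₁ U₁ → InterlatticeLubProperty P₂ L₂ U₂ →
                      InterlatticeLubProperty (×-poset P₁ P₂) (L₁ ⟨×⟩ L₂) (U₁ ⟨×⟩ U₂)
  ×-interlatticeLub lubs₁ lubs₂ ilp₁ ilp₂ = interlatticeLub-viaLub (×-poset P₁ P₂)
    λ b (b₁∈U , b₂∈U) S S⊆L b-ub →
      let open ComponentwiseLub P₁ P₂ lubs₁ lubs₂ S S⊆L
      in componentwiseLub , componentwiseLub-isLub
         , ( ilp₁ (proj₁ b) b₁∈U _ components₁⊆Q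
                  (image-⊆ P₁ (λ p p∈S → proj₁ (b-ub p p∈S))) _ (proj₂ lub₁)
           , ilp₂ (proj₂ b) b₂∈U _ components₂⊆Q
                  (image-⊆ P₂ (λ p p∈S → proj₂ (b-ub p p∈S))) _ (proj₂ lub₂))

×-completeLattice : ∀ P₁ P₂ {Q₁ Q₂} → IsCompleteLatticeOn P₁ Q₁ → IsCompleteLatticeOn P₂ Q₂ →
                    IsCompleteLatticeOn (×-poset P₁ P₂) (Q₁ ⟨×⟩ Q₂)
×-completeLattice P₁ P₂ Q₁-complete Q₂-complete =
  completeLattice (×-poset P₁ P₂)
    (×-hasLubs P₁ P₂ (lubs P₁ Q₁-complete) (lubs P₂ Q₂-complete))
    (×-hasLubs (≥-poset P₁) (≥-poset P₂) (glbs P₁ Q₁-complete) (glbs P₂ Q₂-complete))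

×-isApproxTupleOn : (A B : ApproxTuple) →
  let module A = ApproxTuple A; module B = ApproxTuple B
  in IsApproxTupleOn (×-poset A.base B.base) (A.L ⟨×⟩ B.L) (A.U ⟨×⟩ B.U)
×-isApproxTupleOn A B = record
  { ⊤ = A.⊤ , B.⊤
  ; ⊥ = A.⊥ , B.⊥
  ; ⊤-max = λ (a , b) → A.⊤-max a , B.⊤-max b
  ; ⊥-min = λ (a , b) → A.⊥-min a , B.⊥-min b
  ; ⊤∈L = A.⊤∈L , B.⊤∈L
  ; ⊤∈U = A.⊤∈U , B.⊤∈U
  ; ⊥∈L = A.⊥∈L , B.⊥∈L
  ; ⊥∈U = A.⊥∈U , B.⊥∈U
  ; L-complete = ×-completeLattice A.base B.base A.L-complete B.L-complete
  ; U-complete = ×-completeLattice A.base B.base A.U-complete B.U-complete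
  ; ILP = ×-interlatticeLub A.base B.base (lubs A.base A.L-complete) (lubs B.base B.L-complete) A.ILP B.ILP
  ; IGP = ×-interlatticeLub (≥-poset A.base) (≥-poset B.base)
            (glbs A.base A.U-complete) (glbs B.base B.U-complete) A.IGP B.IGP
  }
  where module A = ApproxTuple A
        module B = ApproxTuple B

→-poset : Set → Poset₀ → Poset₀
→-poset X C = record
  { Carrier = X → Carrier
  ; _≈_ = λ f g → ∀ i → f i ≈ g i
  ; _≤_ = λ f g → ∀ i → f i ≤ g i
  ; isPartialOrder = record
    { isPreorder = record
      { isEquivalence = record
        { refl = λ _ → Eq.refl
        ; sym = λ f≈g i → Eq.sym (f≈g i)
        ; trans = λ f≈g g≈h i → Eq.trans (f≈g i) (g≈h i)
        }
      ; reflexive = λ f≈g i → reflexive (f≈g i)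
      ; trans = λ f≤g g≤h i → trans (f≤g i) (g≤h i)
      }
    ; antisym = λ f≤g g≤f i → antisym (f≤g i) (g≤f i)
    }
  }
  where open Poset C

Pointwise : (X : Set) (C : Poset₀) → Subset C → Subset (→-poset X C)
Pointwise X C Q f = ∀ i → Q (f i)

module PointwiseLub (X : Set) (C : Poset₀) {Q : Subset C} (lubsC : HasLubsIn C Q)
         (S : Subset (→-poset X C)) (S⊆Q : _⊆_ (→-poset X C) S (Pointwise X C Q)) where
  open Poset C using (Carrier)

  lubAt : ∀ i → Σ[ x ∈ Carrier ] IsLubIn C Q (Image C (λ f → f i) S) x
  lubAt i = lubsC (Image C (λ f → f i) S) (image-⊆ C (λ f f∈S → S⊆Q f f∈S i))

  pointwiseLub : X → Carrier
  pointwiseLub i = proj₁ (lubAt i)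

  pointwiseLub-isLub : IsLubIn (→-poset X C) (Pointwise X C Q) S pointwiseLub
  pointwiseLub-isLub =
    (λ i → proj₁ (proj₂ (lubAt i)))
    , (λ f f∈S i → proj₁ (proj₂ (proj₂ (lubAt i))) (f i) (f , f∈S , refl))
    , (λ b b∈Q b-ub i → proj₂ (proj₂ (proj₂ (lubAt i))) (b i) (b∈Q i)
                          (image-⊆ C (λ f f∈S → b-ub f f∈S i)))

pointwise-hasLubs : ∀ X C {Q} (lubsC : HasLubsIn C Q) (M : Subset (→-poset X C)) →
  (∀ S (S⊆M : _⊆_ (→-poset X C) S (Pointwise X C Q ∩ M)) →
     M (PointwiseLub.pointwiseLub X C lubsC S (λ f f∈S → proj₁ (S⊆M f f∈S)))) →
  HasLubsIn (→-poset X C) (Pointwise X C Q ∩ M)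
pointwise-hasLubs X C lubsC M M-closed S S⊆M =
  let g-lub = PointwiseLub.pointwiseLub-isLub X C lubsC S (λ f f∈S → proj₁ (S⊆M f f∈S))
  in _ , lubIn-⊆ (→-poset X C) (λ _ → proj₁) (proj₁ g-lub , M-closed S S⊆M) g-lub

module _ (D C : Poset₀) where
  private
    module D = Poset D
    module C = Poset C

  IsMonotone : Subset (→-poset D.Carrier C)
  IsMonotone f = f Preserves D._≤_ ⟶ C._≤_

  MonotoneInto : Subset C → Subset (→-poset D.Carrier C)
  MonotoneInto Q = Pointwise D.Carrier C Q ∩ IsMonotone

AntitoneInto : (D C : Poset₀) → Subset C → Subset (→-poset (Poset.Carrier D) C)
AntitoneInto D C = MonotoneInto D (≥-poset C)

module _ (D C : Poset₀) {Q : Subset C} (lubsC : HasLubsIn C Q) where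
  open Poset C using (trans)
  private
    X = Poset.Carrier D

  monotoneInto-hasLubs : HasLubsIn (→-poset X C) (MonotoneInto D C Q)
  monotoneInto-hasLubs = pointwise-hasLubs X C lubsC (IsMonotone D C) λ S S⊆M {i} {j} i≤j →
    let open PointwiseLub X C lubsC S (λ f f∈S → proj₁ (S⊆M f f∈S))
        (_ , _ , gᵢ-least) = proj₂ (lubAt i)
        (g∈Q , g-ub , _) = pointwiseLub-isLub
    in gᵢ-least _ (g∈Q j) (image-⊆ C (λ f f∈S → trans (proj₂ (S⊆M f f∈S) i≤j) (g-ub f f∈S j)))

  antitoneInto-hasLubs : HasLubsIn (→-poset X C) (AntitoneInto D C Q)
  antitoneInto-hasLubs = pointwise-hasLubs X C lubsC (IsMonotone D (≥-poset C)) λ S S⊆A {i} {j} i≤j →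
    let open PointwiseLub X C lubsC S (λ f f∈S → proj₁ (S⊆A f f∈S))
        (_ , _ , gⱼ-least) = proj₂ (lubAt j)
        (g∈Q , g-ub , _) = pointwiseLub-isLub
    in gⱼ-least _ (g∈Q i) (image-⊆ C (λ f f∈S → trans (proj₂ (S⊆A f f∈S) i≤j) (g-ub f f∈S i)))

module _ (D C : Poset₀) where
  private
    X = Poset.Carrier D

  monotoneInto-completeLattice : ∀ {Q} → IsCompleteLatticeOn C Q →
                                 IsCompleteLatticeOn (→-poset X C) (MonotoneInto D C Q)
  monotoneInto-completeLattice Q-complete =
    completeLattice (→-poset X C) (monotoneInto-hasLubs D C (lubs C Q-complete))
                                  (antitoneInto-hasLubs D (≥-poset C) (glbs C Q-complete))

  antitoneInto-completeLattice : ∀ {Q} → IsCompleteLatticeOn C Q →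
                                 IsCompleteLatticeOn (→-poset X C) (AntitoneInto D C Q)
  antitoneInto-completeLattice Q-complete =
    completeLattice (→-poset X C) (antitoneInto-hasLubs D C (lubs C Q-complete))
                                  (monotoneInto-hasLubs D (≥-poset C) (glbs C Q-complete))

  monotoneInto-interlatticeLub :
    ∀ {L U} → HasLubsIn C L → InterlatticeLubProperty C L U →
    InterlatticeLubProperty (→-poset X C) (MonotoneInto D C L) (AntitoneInto D C U)
  monotoneInto-interlatticeLub lubsL ilp = interlatticeLub-viaLub (→-poset X C)
    λ b (b∈U , _) S S⊆M b-ub →
      let S⊆L = λ f f∈S → proj₁ (S⊆M f f∈S)
          open PointwiseLub X C lubsL S S⊆L
      in pointwiseLub , proj₂ (monotoneInto-hasLubs D C lubsL S S⊆M)
       , λ i → ilp (b i) (b∈U i) _ (image-⊆ C (λ f f∈S → S⊆L f f∈S i))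
                   (image-⊆ C (λ f f∈S → b-ub f f∈S i)) _ (proj₂ (lubAt i))

⇒-isApproxTupleOn : (D : Poset₀) (T : ApproxTuple) →
  let module T = ApproxTuple T
  in IsApproxTupleOn (→-poset (Poset.Carrier D) T.base) (MonotoneInto D T.base T.L)
                                                       (AntitoneInto D T.base T.U)
⇒-isApproxTupleOn D T = record
  { ⊤ = λ _ → T.⊤
  ; ⊥ = λ _ → T.⊥
  ; ⊤-max = λ f i → T.⊤-max (f i)
  ; ⊥-min = λ f i → T.⊥-min (f i)
  ; ⊤∈L = (λ _ → T.⊤∈L) , λ _ → Poset.refl T.base
  ; ⊤∈U = (λ _ → T.⊤∈U) , λ _ → Poset.refl T.base
  ; ⊥∈L = (λ _ → T.⊥∈L) , λ _ → Poset.refl T.base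
  ; ⊥∈U = (λ _ → T.⊥∈U) , λ _ → Poset.refl T.base
  ; L-complete = monotoneInto-completeLattice D T.base T.L-complete
  ; U-complete = antitoneInto-completeLattice D T.base T.U-complete
  ; ILP = monotoneInto-interlatticeLub D T.base (lubs T.base T.L-complete) T.ILP
  ; IGP = monotoneInto-interlatticeLub D (≥-poset T.base) (glbs T.base T.U-complete) T.IGP
  }
  where module T = ApproxTuple T

_×ᵀ_ : ApproxTuple → ApproxTuple → ApproxTuple
A ×ᵀ B = approxTupleOn (×-isApproxTupleOn A B)

_⇒ᵀ_ : ApproxTuple → ApproxTuple → ApproxTuple
B ⇒ᵀ C = approxTupleOn (⇒-isApproxTupleOn (ApproxSpace B) C)

⊤ᵀ : ApproxTuple
⊤ᵀ = record
  { base = Unit.≡-poset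
  ; L = λ _ → Unit
  ; U = λ _ → Unit
  ; cover = λ _ → inj₁ tt
  ; ⊤ = tt
  ; ⊥ = tt
  ; ⊤-max = λ _ → refl
  ; ⊥-min = λ _ → refl
  ; ⊤∈L = tt
  ; ⊤∈U = tt
  ; ⊥∈L = tt
  ; ⊥∈U = tt
  ; L-complete = λ _ _ → (tt , tt , (λ _ _ → refl) , λ _ _ _ → refl)
                       , (tt , tt , (λ _ _ → refl) , λ _ _ _ → refl)
  ; U-complete = λ _ _ → (tt , tt , (λ _ _ → refl) , λ _ _ _ → refl)
                       , (tt , tt , (λ _ _ → refl) , λ _ _ _ → refl)
  ; ILP = λ _ _ _ _ _ _ _ → refl
  ; IGP = λ _ _ _ _ _ _ _ → refl
  }

ApproxSpaces : Category _ _ _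
ApproxSpaces = FullSubcategory ChainCompletePosets
                 (λ T → asCCPoset T (approxSpace-chainComplete T))

open Monotone

monotone-resp-≈ : ∀ {P Q} (f : Monotone P Q) {x y} →
                  Poset._≈_ P x y → Poset._≈_ Q (fun f x) (fun f y)
monotone-resp-≈ {P} {Q} f x≈y =
  Poset.antisym Q (monotone f (Poset.reflexive P x≈y))
                  (monotone f (Poset.reflexive P (Poset.Eq.sym P x≈y)))

⊤ᵀ-isTerminal : IsTerminal ApproxSpaces ⊤ᵀ
⊤ᵀ-isTerminal X = mono (λ _ → ⟨ tt , tt ⟩[ tt , tt , refl ]) (λ _ → refl , refl)
                , λ _ _ → refl , refl

module _ (A B : ApproxTuple) where
  private
    module A = Poset (ApproxTuple.base A)
    module B = Poset (ApproxTuple.base B)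

  pair : ⊗Elem A → ⊗Elem B → ⊗Elem (A ×ᵀ B)
  pair a b = ⟨ ((lo a , lo b) , inj₁ (lo∈L a , lo∈L b)) , ((hi a , hi b) , inj₂ (hi∈U a , hi∈U b))
             ⟩[ (lo∈L a , lo∈L b) , (hi∈U a , hi∈U b) , (lo≤hi a , lo≤hi b) ]

  ⟨_,_⟩ᵐ : ∀ {P} → Monotone P (ApproxSpace A) → Monotone P (ApproxSpace B) →
           Monotone P (ApproxSpace (A ×ᵀ B))
  ⟨ f , g ⟩ᵐ = mono (λ x → pair (fun f x) (fun g x)) λ x≤y →
    let (lo≤ , hi≥) = monotone f x≤y ; (lo≤′ , hi≥′) = monotone g x≤y
    in (lo≤ , lo≤′) , (hi≥ , hi≥′)

  fst : Monotone (ApproxSpace (A ×ᵀ B)) (ApproxSpace A)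
  fst = mono (λ p → ⟨ proj₁ (proj₁ (lo p)) , proj₁ (proj₁ (hi p))
                    ⟩[ proj₁ (lo∈L p) , proj₁ (hi∈U p) , proj₁ (lo≤hi p) ])
             (λ (lo≤ , hi≥) → proj₁ lo≤ , proj₁ hi≥)

  snd : Monotone (ApproxSpace (A ×ᵀ B)) (ApproxSpace B)
  snd = mono (λ p → ⟨ proj₂ (proj₁ (lo p)) , proj₂ (proj₁ (hi p))
                    ⟩[ proj₂ (lo∈L p) , proj₂ (hi∈U p) , proj₂ (lo≤hi p) ])
             (λ (lo≤ , hi≥) → proj₂ lo≤ , proj₂ hi≥)

  pair-fst-snd : ∀ p → Poset._≈_ (ApproxSpace (A ×ᵀ B)) (pair (fun fst p) (fun snd p)) p
  pair-fst-snd p = (A.Eq.refl , B.Eq.refl) , (A.Eq.refl , B.Eq.refl)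

  ×ᵀ-isProduct : IsProduct ApproxSpaces A B (A ×ᵀ B) fst snd
  ×ᵀ-isProduct X f g =
    ⟨ f , g ⟩ᵐ , (λ _ → A.Eq.refl , A.Eq.refl) , (λ _ → B.Eq.refl , B.Eq.refl)
    , λ u fst∘u≈f snd∘u≈g x → let (lo≈ , hi≈) = fst∘u≈f x ; (lo≈′ , hi≈′) = snd∘u≈g x
                               in (lo≈ , lo≈′) , (hi≈ , hi≈′)

products : ∀ A B → Product ApproxSpaces A B
products A B = record { obj = A ×ᵀ B ; π₁ = fst A B ; π₂ = snd A B ; isProduct = ×ᵀ-isProduct A B }

module _ (B C : ApproxTuple) where
  private
    module C = Poset (ApproxTuple.base C)

  apply : ⊗Elem (B ⇒ᵀ C) → ⊗Elem B → ⊗Elem C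
  apply φ b = ⟨ proj₁ (lo φ) b , proj₁ (hi φ) b
              ⟩[ proj₁ (lo∈L φ) b , proj₁ (hi∈U φ) b , lo≤hi φ b ]

  apply-monotone : ∀ {φ φ′ b b′} → Poset._≤_ (ApproxSpace (B ⇒ᵀ C)) φ φ′ →
                   Poset._≤_ (ApproxSpace B) b b′ → Poset._≤_ (ApproxSpace C) (apply φ b) (apply φ′ b′)
  apply-monotone {φ} {b′ = b′} (lo≤ , hi≥) b≤b′ =
    C.trans (proj₂ (lo∈L φ) b≤b′) (lo≤ b′) , C.trans (hi≥ b′) (proj₂ (hi∈U φ) b≤b′)

  eval : Monotone (ApproxSpace ((B ⇒ᵀ C) ×ᵀ B)) (ApproxSpace C)
  eval = mono (λ w → apply (fun π₁ w) (fun π₂ w)) λ {w} {w′} w≤w′ →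
    apply-monotone {fun π₁ w} {fun π₁ w′} {fun π₂ w} {fun π₂ w′}
                   (monotone π₁ {w} {w′} w≤w′) (monotone π₂ {w} {w′} w≤w′)
    where
      π₁ = fst (B ⇒ᵀ C) B
      π₂ = snd (B ⇒ᵀ C) B

  reify : Monotone (ApproxSpace B) (ApproxSpace C) → ⊗Elem (B ⇒ᵀ C)
  reify h = ⟨ (lo ∘ fun h , inj₁ lo∘h∈L) , (hi ∘ fun h , inj₂ hi∘h∈U)
            ⟩[ lo∘h∈L , hi∘h∈U , lo≤hi ∘ fun h ]
    where
      lo∘h∈L = lo∈L ∘ fun h , λ {b} {b′} b≤b′ → proj₁ (monotone h {b} {b′} b≤b′)
      hi∘h∈U = hi∈U ∘ fun h , λ {b} {b′} b≤b′ → proj₂ (monotone h {b} {b′} b≤b′)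

  reify-monotone : ∀ {h h′} → (∀ b → Poset._≤_ (ApproxSpace C) (fun h b) (fun h′ b)) →
                   Poset._≤_ (ApproxSpace (B ⇒ᵀ C)) (reify h) (reify h′)
  reify-monotone h≤h′ = (λ b → proj₁ (h≤h′ b)) , (λ b → proj₂ (h≤h′ b))

  module _ {Y : ApproxTuple} (f : Monotone (ApproxSpace (Y ×ᵀ B)) (ApproxSpace C)) where
    private
      module Y = Poset (ApproxTuple.base Y)
      module B = Poset (ApproxTuple.base B)

    section : ⊗Elem Y → Monotone (ApproxSpace B) (ApproxSpace C)
    section y = mono (λ b → fun f (pair Y B y b))
                     (λ (lo≤ , hi≥) → monotone f ((Y.refl , lo≤) , (Y.refl , hi≥)))

    curry : Monotone (ApproxSpace Y) (ApproxSpace (B ⇒ᵀ C))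
    curry = mono (reify ∘ section)
                 λ {y} {y′} (lo≤ , hi≥) → reify-monotone {section y} {section y′}
                   λ _ → monotone f ((lo≤ , B.refl) , (hi≥ , B.refl))

-- Up to η for ⊗Elem, apply (reify h) is h and fst, snd of pair y b are y, b; so β holds by
-- pair-fst-snd, and the hypothesis of uniqueness at pair y b is already its conclusion at y.
exponentials : ∀ B C → Exponential ApproxSpaces products B C
exponentials B C = record
  { obj = B ⇒ᵀ C
  ; eval = eval B C
  ; isExponential = λ Y f →
      curry B C f
      , (λ w → monotone-resp-≈ f (pair-fst-snd Y B w))
      , λ g eval∘g≈f y → (λ b → proj₁ (eval∘g≈f (pair Y B y b)))
                       , (λ b → proj₂ (eval∘g≈f (pair Y B y b)))
  }

theorem1 : Σ[ cc ∈ (∀ (T : ApproxTuple) → IsChainComplete (ApproxSpace T)) ]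
    CartesianClosed
    (FullSubcategory ChainCompletePosets (λ T → asCCPoset T (cc T)))
theorem1 = approxSpace-chainComplete , record
  { terminal = ⊤ᵀ
  ; terminal-isTerminal = ⊤ᵀ-isTerminal
  ; product = products
  ; exponential = exponentials
  }
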